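{- Player $I$ has a winning strategy in $G_1(\mathcal{ED})$, and if $\mathcal{I}$ is an ideal on $\omega$ which is not tall, then player $II$ has a winning strategy in $G_1(\mathcal{I})$.
   Context: Cut and choose game $G_1(\mathcal{I})$ for an ideal $\mathcal{I}$ on a countable set $X$: in the first move player $I$ partitions $X=A^0_0\cup A^0_1$ and player $II$ answers with $i_0\in 2$ and $n_0\in A^0_{i_0}$; in move $m+1$ player $I$ partitions the previously chosen piece $A^m_{i_m}$ into two pieces $A^{m+1}_0\cup A^{m+1}_1$ and player $II$ answers with $i_{m+1}\in2$ and $n_{m+1}\in A^{m+1}_{i_{m+1}}$. Player $I$ wins if $\{n_j:j\in\omega\}\in\mathcal{I}$, otherwise player $II$ wins. $\mathcal{ED}$ is the ideal on $\omega\times\omega$ generated by the columns $\{n\}\times\omega$ ($n\in\omega$) and the graphs of functions $f:\omega\to\omega$. An ideal $\mathcal{I}$ on $\omega$ is tall if every infinite $A\subseteq\omega$ has infinite intersection with some member of $\mathcal{I}$. Ideals contain all finite sets. -}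

module Defs where

open import Level using (0ℓ)
open import Data.Bool using (Bool)
open import Data.Nat using (ℕ; _<_; _≤_)
open import Data.Product using (Σ; ∃; _×_; _,_; proj₁; proj₂)
open import Data.Sum using (_⊎_)
open import Data.List using (List; map; upTo)
open import Data.List.Relation.Unary.Any using (Any)
open import Relation.Nullary using (¬_)
open import Relation.Unary using (Pred; _⊆_; _∪_; _∩_; U; _∈_; _∉_)
open import Relation.Binary.PropositionalEquality using (_≡_)

Subset : Set → Set₁
Subset X = Pred X 0ℓ

IdealPred : Set → Set₁
IdealPred X = Subset X → Set

Finite : Subset ℕ → Set
Finite A = ∃ λ n → ∀ x → x ∈ A → x < n

Infinite : Subset ℕ → Set
Infinite A = ¬ Finite A

record IsIdeal (I : IdealPred ℕ) : Set₁ where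
  field
    downward : ∀ {A B : Subset ℕ} → A ⊆ B → I B → I A
    unionClosed : ∀ {A B : Subset ℕ} → I A → I B → I (A ∪ B)
    finiteIn : ∀ {A : Subset ℕ} → Finite A → I A
    proper : ¬ I U

Tall : IdealPred ℕ → Set₁
Tall I = ∀ (A : Subset ℕ) → Infinite A → Σ (Subset ℕ) λ B → I B × Infinite (A ∩ B)

-- The ideal ED on ω × ω generated by columns {n} × ω and graphs of
-- functions ω → ω: A ∈ ED iff A is covered by finitely many columns
-- (w.l.o.g. the columns 0 … n-1) and finitely many graphs.
ED : IdealPred (ℕ × ℕ)
ED A = Σ ℕ λ n → Σ (List (ℕ → ℕ)) λ fs →
         ∀ p → p ∈ A → (proj₁ p < n) ⊎ Any (λ f → f (proj₁ p) ≡ proj₂ p) fs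

-- A move of player I partitions the current piece P into
-- P ∩ {x | c x ≡ false} and P ∩ {x | c x ≡ true}, given by a colouring
-- c : X → Bool.  A move of player II is a pair (i , n) with i : Bool the
-- chosen piece and n an element of it.  The piece chosen after moves
-- (c₀,i₀),…,(c_m,i_m) is {x | ∀ k ≤ m, c_k x ≡ i_k}.

Range : {X : Set} → (ℕ → X) → Subset X
Range n x = ∃ λ j → n j ≡ x

StrategyI : Set → Set
StrategyI X = List (Bool × X) → (X → Bool)

-- Strategy of player II: from the list of I's partitions so far
-- (including the current one) to a move.
StrategyII : Set → Set
StrategyII X = List (X → Bool) → Bool × X

-- σ is winning for I: every play of II legal against σ produces a set in I.
-- (II's moves form a sequence p; I's k-th partition is σ applied to II's
-- first k moves; legality: n_m lies in the piece chosen at every k ≤ m.)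
IWinning : {X : Set} → IdealPred X → StrategyI X → Set
IWinning {X} I σ =
  (p : ℕ → Bool × X) →
  (∀ m k → k ≤ m → σ (map p (upTo k)) (proj₂ (p m)) ≡ proj₁ (p k)) →
  I (Range (λ j → proj₂ (p j)))

IIWinning : {X : Set} → IdealPred X → StrategyII X → Set
IIWinning {X} I τ =
  (c : ℕ → (X → Bool)) →
  let mv : ℕ → Bool × X
      mv m = τ (map c (upTo (Data.Nat.suc m)))
  in (∀ m k → k ≤ m → c k (proj₂ (mv m)) ≡ proj₁ (mv k))
     × (Range (λ j → proj₂ (mv j)) ∉ I)

IHasWinningStrategy : {X : Set} → IdealPred X → Set
IHasWinningStrategy {X} I = Σ (StrategyI X) (IWinning I)

IIHasWinningStrategy : {X : Set} → IdealPred X → Set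
IIHasWinningStrategy {X} I = Σ (StrategyII X) (IIWinning I)

-- Player I, facing the ideal ED, asks at each step whether II's next point lies
-- in a column beyond all columns II has used so far.  If II ever answers "no",
-- the rest of the play stays in finitely many columns; if II always answers
-- "yes", the columns strictly increase and the play is the graph of a function.
--
-- For a non-tall ideal, player II works inside an infinite set A: of the two
-- halves offered, one meets the current piece of A in an infinite set, so II can
-- take that half and a point of it beyond the current step, which produces an
-- infinite subset of A.  If such a play always avoided I, II would win; so if II
-- has no winning strategy, every infinite A has an infinite subset in I, i.e. I
-- is tall.
module Submission where

open import Defs
open import Level using (0ℓ)
open import Axiom.ExcludedMiddle using (ExcludedMiddle)
open import Axiom.DoubleNegationElimination using (em⇒dne)
open import Data.Bool using (Bool; true; false; T)
open import Data.Bool.Properties using (T-≡; ¬-not)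
open import Data.Empty using (⊥-elim)
open import Data.List using (List; []; _∷_; map; foldr; upTo; applyUpTo)
open import Data.List.Properties using (map-applyUpTo)
open import Data.List.Membership.Propositional using () renaming (_∈_ to _∈ₗ_)
open import Data.List.Membership.Propositional.Properties using (∈-map⁺; ∈-upTo⁺)
open import Data.List.Relation.Unary.Any using (here; there)
open import Data.Nat using (ℕ; zero; suc; _+_; _⊔_; _<_; _≤_; _<ᵇ_; z≤n; s≤s)
open import Data.Nat.Properties
open import Data.Product using (Σ; ∃; _×_; _,_; proj₁; proj₂)
open import Data.Sum using (inj₁; inj₂)
open import Function using (_∘_)
open import Function.Bundles using (Equivalence)
open import Relation.Binary.Definitions using (tri<; tri≈; tri>)
open import Relation.Binary.PropositionalEquality using (_≡_; refl; sym; cong; cong₂; subst; trans; module ≡-Reasoning)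
open import Relation.Nullary using (¬_; Dec; yes; no)
open import Relation.Unary using (_⊆_; _∪_; _∩_; _∈_)

Finite-⊆ : {S T : Subset ℕ} → S ⊆ T → Finite T → Finite S
Finite-⊆ S⊆T (n , bound) = n , λ x x∈S → bound x (S⊆T x∈S)

Infinite-mono : {S T : Subset ℕ} → S ⊆ T → Infinite S → Infinite T
Infinite-mono S⊆T infS finT = infS (Finite-⊆ S⊆T finT)

Finite-∪ : {S T : Subset ℕ} → Finite S → Finite T → Finite (S ∪ T)
Finite-∪ (m , boundS) (n , boundT) = m ⊔ n , λ
  { x (inj₁ x∈S) → ≤-trans (boundS x x∈S) (m≤m⊔n m n)
  ; x (inj₂ x∈T) → ≤-trans (boundT x x∈T) (m≤n⊔m m n)
  }

unbounded⇒Infinite : {S : Subset ℕ} → (∀ n → ∃ λ x → x ∈ S × n ≤ x) → Infinite S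
unbounded⇒Infinite unbounded (n , bound) =
  let (x , x∈S , n≤x) = unbounded n in <⇒≱ (bound x x∈S) n≤x

module _ (em : ExcludedMiddle 0ℓ) where

  Infinite⇒unbounded : {S : Subset ℕ} → Infinite S → ∀ n → ∃ λ x → x ∈ S × n ≤ x
  Infinite⇒unbounded infS n = em⇒dne em λ none →
    infS (n , λ x x∈S → ≰⇒> (λ n≤x → none (x , x∈S , n≤x)))

  Infinite-split : {S : Subset ℕ} (d : ℕ → Bool) → Infinite S →
                   Σ Bool λ i → Infinite (S ∩ λ x → d x ≡ i)
  Infinite-split {S} d infS with em {Infinite (S ∩ λ x → d x ≡ true)}
  ... | yes infTrue = true , infTrue
  ... | no finTrue = false , λ finFalse →
    infS (Finite-⊆ byColour (Finite-∪ (em⇒dne em finTrue) finFalse))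
    where
    byColour : S ⊆ ((S ∩ λ x → d x ≡ true) ∪ (S ∩ λ x → d x ≡ false))
    byColour {x} x∈S = sort (d x) refl
      where
      sort : ∀ i → d x ≡ i → x ∈ ((S ∩ λ x → d x ≡ true) ∪ (S ∩ λ x → d x ≡ false))
      sort true dx = inj₁ (x∈S , dx)
      sort false dx = inj₂ (x∈S , dx)

ED-columns : {A : Subset (ℕ × ℕ)} (n : ℕ) → (∀ p → p ∈ A → proj₁ p < n) → ED A
ED-columns n inColumns = n , [] , λ p p∈A → inj₁ (inColumns p p∈A)

ED-functional : ExcludedMiddle 0ℓ → {A : Subset (ℕ × ℕ)} →
                (∀ {p q} → p ∈ A → q ∈ A → proj₁ p ≡ proj₁ q → proj₂ p ≡ proj₂ q) →
                ED A
ED-functional em {A} functional = 0 , f ∷ [] , λ p p∈A → inj₂ (here (f-graph p∈A em))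
  where
  HasValueAt : ℕ → Set
  HasValueAt x = ∃ λ q → q ∈ A × proj₁ q ≡ x

  valueAt : ∀ {x} → Dec (HasValueAt x) → ℕ
  valueAt (yes (q , _)) = proj₂ q
  valueAt (no _) = 0

  f : ℕ → ℕ
  f x = valueAt (em {HasValueAt x})

  f-graph : ∀ {p} → p ∈ A → (value? : Dec (HasValueAt (proj₁ p))) → valueAt value? ≡ proj₂ p
  f-graph p∈A (yes (q , q∈A , same)) = functional q∈A p∈A same
  f-graph {p} p∈A (no none) = ⊥-elim (none (p , p∈A , refl))

maxColumn : List (Bool × ℕ × ℕ) → ℕ
maxColumn = foldr (λ move m → proj₁ (proj₂ move) ⊔ m) 0

maxColumn-≥ : ∀ {move moves} → move ∈ₗ moves → proj₁ (proj₂ move) ≤ maxColumn moves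
maxColumn-≥ (here refl) = m≤m⊔n _ _
maxColumn-≥ {moves = move′ ∷ _} (there move∈moves) =
  ≤-trans (maxColumn-≥ move∈moves) (m≤n⊔m (proj₁ (proj₂ move′)) _)

beyondColumns : StrategyI (ℕ × ℕ)
beyondColumns moves x = maxColumn moves <ᵇ proj₁ x

module BeyondColumnsPlay (em : ExcludedMiddle 0ℓ) (p : ℕ → Bool × ℕ × ℕ)
  (legal : ∀ m k → k ≤ m → beyondColumns (map p (upTo k)) (proj₂ (p m)) ≡ proj₁ (p k))
  where

  column : ℕ → ℕ
  column j = proj₁ (proj₂ (p j))

  bound : ℕ → ℕ
  bound k = maxColumn (map p (upTo k))

  bound-earlier : ∀ {j k} → j < k → column j ≤ bound k
  bound-earlier j<k = maxColumn-≥ (∈-map⁺ p (∈-upTo⁺ j<k))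

  within-after-false : ∀ {k} → proj₁ (p k) ≡ false → ∀ m → column m ≤ bound k
  within-after-false {k} false-at-k m with m <? k
  ... | yes m<k = bound-earlier m<k
  ... | no m≮k = ≮⇒≥ λ beyond →
    subst T (trans (legal m k (≮⇒≥ m≮k)) false-at-k) (<⇒<ᵇ beyond)

  module _ (always-true : ∀ k → proj₁ (p k) ≡ true) where

    column-increasing : ∀ {j m} → j < m → column j < column m
    column-increasing {m = m} j<m = ≤-<-trans (bound-earlier j<m)
      (<ᵇ⇒< _ _ (Equivalence.from T-≡ (trans (legal m m ≤-refl) (always-true m))))

    column-injective : ∀ {j m} → column j ≡ column m → j ≡ m
    column-injective {j} {m} same with <-cmp j m
    ... | tri< j<m _ _ = ⊥-elim (<-irrefl same (column-increasing j<m))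
    ... | tri≈ _ j≡m _ = j≡m
    ... | tri> _ _ m<j = ⊥-elim (<-irrefl (sym same) (column-increasing m<j))

  range-ED : ED (Range (proj₂ ∘ p))
  range-ED with em {∃ λ k → proj₁ (p k) ≡ false}
  ... | yes (k , false-at-k) =
    ED-columns (suc (bound k)) λ { _ (m , refl) → s≤s (within-after-false false-at-k m) }
  ... | no never-false = ED-functional em λ { (j , refl) (m , refl) same →
    cong (proj₂ ∘ proj₂ ∘ p) (column-injective (λ k → ¬-not λ eq → never-false (k , eq)) same) }

beyondColumns-winning : ExcludedMiddle 0ℓ → IWinning ED beyondColumns
beyondColumns-winning em p legal = BeyondColumnsPlay.range-ED em p legal

module InsideInfiniteSet (em : ExcludedMiddle 0ℓ) where

  InfiniteSubset : Set₁
  InfiniteSubset = Σ (Subset ℕ) Infinite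

  colour : InfiniteSubset → (ℕ → Bool) → Bool
  colour (S , infS) d = proj₁ (Infinite-split em d infS)

  refine : InfiniteSubset → (ℕ → Bool) → InfiniteSubset
  refine (S , infS) d =
    (S ∩ λ x → d x ≡ colour (S , infS) d) , proj₂ (Infinite-split em d infS)

  answer : InfiniteSubset → (ℕ → Bool) → ℕ → Bool × ℕ
  answer s d n = colour s d , proj₁ (Infinite⇒unbounded em (proj₂ (refine s d)) n)

  answer-in-refine : ∀ s d n → proj₂ (answer s d n) ∈ proj₁ (refine s d) × n ≤ proj₂ (answer s d n)
  answer-in-refine s d n = proj₂ (Infinite⇒unbounded em (proj₂ (refine s d)) n)

  respond : InfiniteSubset → ℕ → (ℕ → Bool) → List (ℕ → Bool) → Bool × ℕ
  respond s n d [] = answer s d n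
  respond s n d (d′ ∷ ds) = respond (refine s d) (suc n) d′ ds

  strategy : InfiniteSubset → StrategyII ℕ
  strategy s [] = true , 0    -- never consulted: II moves only after I's first cut
  strategy s (d ∷ ds) = respond s 0 d ds

  pieces : InfiniteSubset → (ℕ → ℕ → Bool) → ℕ → InfiniteSubset
  pieces s c zero = s
  pieces s c (suc k) = refine (pieces s c k) (c k)

  pieces-refine : ∀ s c m → pieces (refine s (c 0)) (c ∘ suc) m ≡ pieces s c (suc m)
  pieces-refine s c zero = refl
  pieces-refine s c (suc m) = cong (λ t → refine t (c (suc m))) (pieces-refine s c m)

  respond-pieces : ∀ s n c m →
    respond s n (c 0) (applyUpTo (c ∘ suc) m) ≡ answer (pieces s c m) (c m) (n + m)
  respond-pieces s n c zero = cong (answer s (c 0)) (sym (+-identityʳ n))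
  respond-pieces s n c (suc m) = begin
    respond (refine s (c 0)) (suc n) (c 1) (applyUpTo (c ∘ suc ∘ suc) m)
      ≡⟨ respond-pieces (refine s (c 0)) (suc n) (c ∘ suc) m ⟩
    answer (pieces (refine s (c 0)) (c ∘ suc) m) (c (suc m)) (suc n + m)
      ≡⟨ cong₂ (λ t k → answer t (c (suc m)) k) (pieces-refine s c m) (sym (+-suc n m)) ⟩
    answer (pieces s c (suc m)) (c (suc m)) (n + suc m)
      ∎
    where open ≡-Reasoning

  pieces-antitone : ∀ s c {k m} → k ≤ m → proj₁ (pieces s c m) ⊆ proj₁ (pieces s c k)
  pieces-antitone s c {m = zero} z≤n x∈piece = x∈piece
  pieces-antitone s c {k} {suc m} k≤1+m x∈piece with m≤n⇒m<n∨m≡n k≤1+m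
  ... | inj₁ (s≤s k≤m) = pieces-antitone s c k≤m (proj₁ x∈piece)
  ... | inj₂ refl = x∈piece

  module Play (s : InfiniteSubset) (c : ℕ → ℕ → Bool) where

    move : ℕ → Bool × ℕ
    move m = strategy s (map c (upTo (suc m)))

    move-answers : ∀ m → move m ≡ answer (pieces s c m) (c m) m
    move-answers m rewrite map-applyUpTo suc c m = respond-pieces s 0 c m

    move-in-piece : ∀ m → proj₂ (move m) ∈ proj₁ (pieces s c (suc m)) × m ≤ proj₂ (move m)
    move-in-piece m rewrite move-answers m = answer-in-refine (pieces s c m) (c m) m

    legal : ∀ m k → k ≤ m → c k (proj₂ (move m)) ≡ proj₁ (move k)
    legal m k k≤m rewrite move-answers k =
      proj₂ (pieces-antitone s c (s≤s k≤m) (proj₁ (move-in-piece m)))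

    range-⊆ : Range (proj₂ ∘ move) ⊆ proj₁ s
    range-⊆ (m , refl) = pieces-antitone s c z≤n (proj₁ (move-in-piece m))

    range-infinite : Infinite (Range (proj₂ ∘ move))
    range-infinite = unbounded⇒Infinite λ n →
      proj₂ (move n) , (n , refl) , proj₂ (move-in-piece n)

¬Tall⇒IIWinning : ExcludedMiddle 0ℓ → (I : IdealPred ℕ) → ¬ Tall I → IIHasWinningStrategy I
¬Tall⇒IIWinning em I notTall = em⇒dne em λ noWin → notTall λ A infA →
  let open InsideInfiniteSet em
      (c , range∈I) = em⇒dne em λ noPlayInI →
        noWin (strategy (A , infA) , λ c →
          Play.legal (A , infA) c , λ range∈I → noPlayInI (c , range∈I))
      open Play (A , infA) c
  in Range (proj₂ ∘ move) , range∈I ,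
     Infinite-mono (λ x∈range → range-⊆ x∈range , x∈range) range-infinite

proposition1p1 : ExcludedMiddle 0ℓ →
    IHasWinningStrategy ED ×
    ((I : IdealPred ℕ) → IsIdeal I → ¬ Tall I → IIHasWinningStrategy I)
proposition1p1 em = (beyondColumns , beyondColumns-winning em) , λ I _ → ¬Tall⇒IIWinning em I
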